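{- For all terms $u,v$ in normal form with $u\sqsubseteq' v$ and every $w\in\mathbb{Z}_\infty$, we have $\langle w\rangle u\sqsubseteq'\langle w\rangle v$ (where both sides are taken in normal form).
   Context: Terms $\mathcal{T}$ ($\mathbb{Z}_\infty=\mathbb{Z}\cup\{\infty\}$, $\infty$ largest, $\infty+n=\infty$): generated by $t ::= \mathtt{x} \mid \mathtt{C}\,t \mid (t_1,\dots,t_n) \mid \overline{\mathtt{C}}\,t \mid \pi_i t \mid t_1+t_2 \mid \mathbf{0} \mid \langle w\rangle t$ ($\mathtt{x}$ a variable, $\mathtt{C}$ a constructor, $n\ge0$, $i\ge1$, $w\in\mathbb{Z}_\infty$; $()$ the empty tuple), quotiented by linearity of every term former (sends $\mathbf{0}$ to $\mathbf{0}$, distributes over $+$) and $+$ associative, commutative, idempotent with neutral $\mathbf{0}$. Reduction: contextual closure of $\overline{\mathtt{C}}\,\mathtt{C}\,t\to t$; $\pi_i(t_1,\dots,t_n)\to t_i$ ($1\le i\le n$); $\langle w\rangle\mathtt{C}\,t\to\langle w+1\rangle t$; $\langle w\rangle(t_1,\dots,t_n)\to\sum_i\langle w+1\rangle t_i$ ($n>0$); $\overline{\mathtt{C}}\langle w\rangle t\to\langle w-1\rangle t$; $\pi_i\langle w\rangle t\to\langle w-1\rangle t$; $\langle w\rangle\langle v\rangle t\to\langle w+v\rangle t$; $\pi_i\mathtt{C}\,t\to\mathbf{0}$; $\pi_i(t_1,\dots,t_n)\to\mathbf{0}$ ($i>n$); $\overline{\mathtt{C}}(t_1,\dots,t_n)\to\mathbf{0}$;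 $\overline{\mathtt{C}}\,\mathtt{D}\,t\to\mathbf{0}$ ($\mathtt{C}\ne\mathtt{D}$); it is strongly normalizing and confluent, $\mathrm{nf}(t)$ the normal form; terms are identified with their normal forms below. A destructor sequence $\vec d$ is $()$ or $d_1\cdots d_k\mathtt{x}$ ($d_j$ some $\overline{\mathtt{C}}$ or $\pi_i$), $|\vec d|=k$; a suffix of $d_1\cdots d_k\mathtt{x}$ is some $d_j\cdots d_k\mathtt{x}$, $1\le j\le k+1$. The relation $\sqsubseteq'$ on terms in normal form is inductively generated by the rules: (1) if $u\sqsubseteq'v$ then $\mathtt{C}\,u\sqsubseteq'\mathtt{C}\,v$; (2) if $u_i\sqsubseteq'v_i$ for $i=1..n$ then $(u_1,\dots,u_n)\sqsubseteq'(v_1,\dots,v_n)$; (3) if $\mathrm{nf}(\langle0\rangle u)\sqsubseteq'\mathrm{nf}(\langle w\rangle v)$ then $u\sqsubseteq'\mathrm{nf}(\langle w\rangle v)$; (4) if for every $i=1..n$ there is $j\in\{1..m\}$ with $\langle w_i\rangle\vec{d_i}\sqsubseteq'\langle w'_j\rangle\vec{b_j}$, then $\sum_{i=1}^n\langle w_i\rangle\vec{d_i}\sqsubseteq'\sum_{j=1}^m\langle w'_j\rangle\vec{b_j}$ (the empty sum being $\mathbf{0}$); (5) if $\vec d$ is a suffix of $\vec b$ and $w'+|\vec d|\le w+|\vec b|$ then $\langle w'\rangle\vec b\sqsubseteq'\langle w\rangle\vec d$; (6) $\vec d\sqsubseteq'\vec d$. -}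

module Defs where

open import Data.Nat using (ℕ; zero; suc; NonZero)
open import Data.Integer using (ℤ; +_; -[1+_]) renaming (_+_ to _+ℤ_; _≤_ to _≤ℤ_)
open import Data.List using (List; []; _∷_; [_]; map; concatMap)
open import Data.List.Membership.Propositional using (_∈_)
open import Data.List.Relation.Binary.Subset.Propositional using (_⊆_)
open import Data.Product using (Σ; _×_; _,_)
open import Data.Unit using (⊤)
open import Data.Empty using (⊥)

data ℤ∞ : Set where
  fin : ℤ → ℤ∞
  ∞   : ℤ∞

infixl 6 _⊕_
_⊕_ : ℤ∞ → ℤ∞ → ℤ∞
fin a ⊕ fin b = fin (a +ℤ b)
fin _ ⊕ ∞     = ∞
∞     ⊕ _     = ∞

infix 4 _≤∞_
data _≤∞_ : ℤ∞ → ℤ∞ → Set where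
  fin≤fin : ∀ {a b} → a ≤ℤ b → fin a ≤∞ fin b
  _≤∞∞    : ∀ w → w ≤∞ ∞

Con : Set
Con = ℕ

Var : Set
Var = ℕ

-- Destructor sequences ending in a variable: d₁ ⋯ dₖ x
-- (each dⱼ is some C̄ or some πᵢ with i ≥ 1).

data XSeq : Set where
  var  : Var → XSeq
  dcon : Con → XSeq → XSeq
  proj : (i : ℕ) → .{{_ : NonZero i}} → XSeq → XSeq

xlen : XSeq → ℕ
xlen (var _)    = zero
xlen (dcon _ s) = suc (xlen s)
xlen (proj _ s) = suc (xlen s)

data DSeq : Set where
  unit : DSeq
  seq  : XSeq → DSeq

∣_∣ : DSeq → ℕ
∣ unit ∣  = zero
∣ seq s ∣ = xlen s

-- suffixes of d₁ ⋯ dₖ x are dⱼ ⋯ dₖ x (1 ≤ j ≤ k+1);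
-- () is regarded as its own (only) suffix.
data XSuffix : XSeq → XSeq → Set where
  here   : ∀ {s} → XSuffix s s
  thereC : ∀ {s t c} → XSuffix s t → XSuffix s (dcon c t)
  thereπ : ∀ {s t i} .{{_ : NonZero i}} → XSuffix s t → XSuffix s (proj i t)

data IsSuffix : DSeq → DSeq → Set where
  unit-suf : IsSuffix unit unit
  seq-suf  : ∀ {s t} → XSuffix s t → IsSuffix (seq s) (seq t)

-- Modulo linearity and ACI of +, every term is a finite set (sum) of
-- "simple" terms containing no + and no 0.  The simple terms in normal
-- form are exactly:
--   C n  |  (n₁,…,nₖ)  |  ⟨w⟩ d⃗  |  d₁⋯dₖ x
-- with d⃗ a destructor sequence (possibly ()).

data NS : Set where
  con   : Con → NS → NS
  tup   : List NS → NS
  angle : ℤ∞ → DSeq → NS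
  dseq  : XSeq → NS

-- A term in normal form: a finite sum of simple normal terms
-- ([] is 0).  Equality of terms is equality of the underlying sets.
Term : Set
Term = List NS

infix 4 _≈_
_≈_ : Term → Term → Set
u ≈ v = (u ⊆ v) × (v ⊆ u)

plain : DSeq → NS
plain unit    = tup []
plain (seq s) = dseq s

one : ℤ∞
one = fin (+ 1)

-- nf(⟨w⟩ n) for a simple normal term n
mutual
  angNS : ℤ∞ → NS → Term
  angNS w (con _ n)      = angNS (w ⊕ one) n
  angNS w (tup [])       = [ angle w unit ]
  angNS w (tup (n ∷ ns)) = angList (w ⊕ one) (n ∷ ns)
  angNS w (angle v d)    = [ angle (w ⊕ v) d ]
  angNS w (dseq s)       = [ angle w (seq s) ]

  angList : ℤ∞ → List NS → Term
  angList w []       = []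
  angList w (n ∷ ns) = angNS w n Data.List.++ angList w ns

ang : ℤ∞ → Term → Term
ang w t = angList w t

conT : Con → Term → Term
conT c t = map (con c) t

-- (t₁,…,tₙ) (by multilinearity: sum over all choices of summands)
choices : List Term → List (List NS)
choices []       = [ [] ]
choices (t ∷ ts) = concatMap (λ a → map (a ∷_) (choices ts)) t

tupT : List Term → Term
tupT ts = map tup (choices ts)

angSum : List (ℤ∞ × DSeq) → Term
angSum ps = map (λ { (w , d) → angle w d }) ps

infix 4 _⊑′_
data _⊑′_ : Term → Term → Set

data Pointwise⊑ : List Term → List Term → Set where
  []  : Pointwise⊑ [] []
  _∷_ : ∀ {u v us vs} → u ⊑′ v → Pointwise⊑ us vs → Pointwise⊑ (u ∷ us) (v ∷ vs)

data _⊑′_ where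
  -- terms are sums up to ACI: ⊑′ respects equality of terms
  resp  : ∀ {u u′ v v′} → u ≈ u′ → v ≈ v′ → u ⊑′ v → u′ ⊑′ v′
  r-con : ∀ {u v} c → u ⊑′ v → conT c u ⊑′ conT c v
  r-tup : ∀ {us vs} → Pointwise⊑ us vs → tupT us ⊑′ tupT vs
  r-ang : ∀ {u v} w → ang (fin (+ 0)) u ⊑′ ang w v → u ⊑′ ang w v
  r-sum : ∀ (ps qs : List (ℤ∞ × DSeq)) →
          (∀ {p} → p ∈ ps → Σ (ℤ∞ × DSeq) λ q → (q ∈ qs) × (angSum [ p ] ⊑′ angSum [ q ])) →
          angSum ps ⊑′ angSum qs
  r-suf : ∀ {w w′ d b} → IsSuffix d b →
          w′ ⊕ fin (+ ∣ d ∣) ≤∞ w ⊕ fin (+ ∣ b ∣) →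
          [ angle w′ b ] ⊑′ [ angle w d ]
  r-refl : ∀ d → [ plain d ] ⊑′ [ plain d ]

-- Every atom of ⟨w⟩u in normal form is an angle ⟨a⟩d⃗, and rules (4) and (5) alone derive
-- t ⊑′ t′ between two sums of angles as soon as every atom of t is related by the suffix
-- condition (5) to some atom of t′.  So it suffices that u ⊑′ v implies this domination of
-- ⟨w⟩u by ⟨w⟩v for every w at once; that invariant is proved by induction on u ⊑′ v,
-- using ⟨w⟩⟨w′⟩t = ⟨w + w′⟩t and that shifting both sides of condition (5) preserves it.
module Submission where

open import Defs
open import Data.Integer using (+_)
import Data.Integer.Properties as ℤ
open import Data.List using ([]; _∷_; [_]; concatMap; _++_)
open import Data.List.Properties using (++-assoc)
open import Data.List.Membership.Propositional using (_∈_; find; lose)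
open import Data.List.Membership.Propositional.Properties
  using (∈-map⁺; ∈-map⁻; ∈-++⁺ˡ; ∈-++⁺ʳ; ∈-++⁻; ∈-concatMap⁺; ∈-concatMap⁻)
open import Data.List.Relation.Binary.Subset.Propositional using (_⊆_)
open import Data.List.Relation.Binary.Subset.Propositional.Properties using (Any-resp-⊆; concatMap⁺)
open import Data.List.Relation.Binary.Pointwise using (Pointwise; []; _∷_)
open import Data.List.Relation.Unary.All using (All; []; _∷_; lookup)
open import Data.List.Relation.Unary.All.Properties using (++⁺)
open import Data.List.Relation.Unary.Any using (Any; here)
open import Data.Product using (∃-syntax; _×_; _,_)
open import Data.Sum using (inj₁; inj₂)
open import Function using (_∘_)
open import Relation.Binary.PropositionalEquality using (_≡_; refl; sym; trans; cong; cong₂; subst; subst₂)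

⊕-assoc : ∀ a b c → (a ⊕ b) ⊕ c ≡ a ⊕ (b ⊕ c)
⊕-assoc (fin a) (fin b) (fin c) = cong fin (ℤ.+-assoc a b c)
⊕-assoc (fin a) (fin b) ∞       = refl
⊕-assoc (fin a) ∞       c       = refl
⊕-assoc ∞       b       c       = refl

⊕-identityʳ : ∀ a → a ⊕ fin (+ 0) ≡ a
⊕-identityʳ (fin a) = cong fin (ℤ.+-identityʳ a)
⊕-identityʳ ∞       = refl

≤∞-refl : ∀ a → a ≤∞ a
≤∞-refl (fin a) = fin≤fin ℤ.≤-refl
≤∞-refl ∞       = ∞ ≤∞∞

⊕-monoʳ-≤∞ : ∀ a {b c} → b ≤∞ c → a ⊕ b ≤∞ a ⊕ c
⊕-monoʳ-≤∞ (fin a) (fin≤fin b≤c) = fin≤fin (ℤ.+-monoʳ-≤ a b≤c)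
⊕-monoʳ-≤∞ (fin a) (b ≤∞∞)       = (fin a ⊕ b) ≤∞∞
⊕-monoʳ-≤∞ ∞       _             = ∞ ≤∞∞

ang-++ : ∀ w t t′ → ang w (t ++ t′) ≡ ang w t ++ ang w t′
ang-++ w []      t′ = refl
ang-++ w (n ∷ t) t′ = trans (cong (angNS w n ++_) (ang-++ w t t′))
                            (sym (++-assoc (angNS w n) (ang w t) (ang w t′)))

mutual
  angNS-ang : ∀ w v n → ang w (angNS v n) ≡ angNS (w ⊕ v) n
  angNS-ang w v (con c n)      = trans (angNS-ang w (v ⊕ one) n)
                                       (cong (λ a → angNS a n) (sym (⊕-assoc w v one)))
  angNS-ang w v (tup [])       = refl
  angNS-ang w v (tup (n ∷ ns)) = trans (ang-ang w (v ⊕ one) (n ∷ ns))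
                                       (cong (λ a → ang a (n ∷ ns)) (sym (⊕-assoc w v one)))
  angNS-ang w v (angle a d)    = cong (λ b → [ angle b d ]) (sym (⊕-assoc w v a))
  angNS-ang w v (dseq s)       = refl

  ang-ang : ∀ w v t → ang w (ang v t) ≡ ang (w ⊕ v) t
  ang-ang w v []      = refl
  ang-ang w v (n ∷ t) = trans (ang-++ w (angNS v n) (ang v t))
                              (cong₂ _++_ (angNS-ang w v n) (ang-ang w v t))

ang-ang₀ : ∀ w t → ang w (ang (fin (+ 0)) t) ≡ ang w t
ang-ang₀ w t = trans (ang-ang w (fin (+ 0)) t) (cong (λ a → ang a t) (⊕-identityʳ w))

ang-conT : ∀ w c t → ang w (conT c t) ≡ ang (w ⊕ one) t
ang-conT w c []      = refl
ang-conT w c (n ∷ t) = cong (angNS (w ⊕ one) n ++_) (ang-conT w c t)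

ang-concatMap : ∀ w t → ang w t ≡ concatMap (angNS w) t
ang-concatMap w []      = refl
ang-concatMap w (n ∷ t) = cong (angNS w n ++_) (ang-concatMap w t)

∈-ang⁻ : ∀ w t {x} → x ∈ ang w t → ∃[ n ] n ∈ t × x ∈ angNS w n
∈-ang⁻ w t x∈ = find (∈-concatMap⁻ (angNS w) (subst (_ ∈_) (ang-concatMap w t) x∈))

∈-ang⁺ : ∀ w t {n x} → n ∈ t → x ∈ angNS w n → x ∈ ang w t
∈-ang⁺ w t n∈ x∈ = subst (_ ∈_) (sym (ang-concatMap w t)) (∈-concatMap⁺ (angNS w) (lose n∈ x∈))

ang-⊆ : ∀ w {t t′} → t ⊆ t′ → ang w t ⊆ ang w t′
ang-⊆ w {t} {t′} t⊆t′ =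
  subst₂ _⊆_ (sym (ang-concatMap w t)) (sym (ang-concatMap w t′)) (concatMap⁺ (angNS w) t⊆t′)

data IsAngle : NS → Set where
  angle : ∀ a d → IsAngle (angle a d)

mutual
  angNS-angles : ∀ w n → All IsAngle (angNS w n)
  angNS-angles w (con c n)      = angNS-angles (w ⊕ one) n
  angNS-angles w (tup [])       = angle w unit ∷ []
  angNS-angles w (tup (n ∷ ns)) = ang-angles (w ⊕ one) (n ∷ ns)
  angNS-angles w (angle a d)    = angle (w ⊕ a) d ∷ []
  angNS-angles w (dseq s)       = angle w (seq s) ∷ []

  ang-angles : ∀ w t → All IsAngle (ang w t)
  ang-angles w []      = []
  ang-angles w (n ∷ t) = ++⁺ (angNS-angles w n) (ang-angles w t)

angNS-inhabited : ∀ w n → ∃[ x ] x ∈ angNS w n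
angNS-inhabited w (con c n)      = angNS-inhabited (w ⊕ one) n
angNS-inhabited w (tup [])       = _ , here refl
angNS-inhabited w (tup (n ∷ ns)) with angNS-inhabited (w ⊕ one) n
... | x , x∈ = x , ∈-++⁺ˡ x∈
angNS-inhabited w (angle a d)    = _ , here refl
angNS-inhabited w (dseq s)       = _ , here refl

angles⇒angSum : ∀ {t} → All IsAngle t → ∃[ ps ] angSum ps ≡ t
angles⇒angSum []                 = [] , refl
angles⇒angSum (angle a d ∷ angs) with angles⇒angSum angs
... | ps , refl = (a , d) ∷ ps , refl

infix 4 _≼_ _◁_ _⊑ˢ_

data _≼_ : NS → NS → Set where
  suffix : ∀ {w w′ d b} → IsSuffix d b → w′ ⊕ fin (+ ∣ d ∣) ≤∞ w ⊕ fin (+ ∣ b ∣) →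
           angle w′ b ≼ angle w d

IsSuffix-refl : ∀ d → IsSuffix d d
IsSuffix-refl unit    = unit-suf
IsSuffix-refl (seq s) = seq-suf here

≼-refl : ∀ {x} → IsAngle x → x ≼ x
≼-refl (angle a d) = suffix (IsSuffix-refl d) (≤∞-refl _)

≼-shift : ∀ a {w w′ d b} → angle w′ b ≼ angle w d → angle (a ⊕ w′) b ≼ angle (a ⊕ w) d
≼-shift a {w} {w′} {d} {b} (suffix suf le) = suffix suf (subst₂ _≤∞_
  (sym (⊕-assoc a w′ (fin (+ ∣ d ∣)))) (sym (⊕-assoc a w (fin (+ ∣ b ∣)))) (⊕-monoʳ-≤∞ a le))

_◁_ : Term → Term → Set
t ◁ t′ = ∀ {x} → x ∈ t → Any (x ≼_) t′

-- Quantifying over every shift w makes the invariant stable under rules (1) and (3).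
_⊑ˢ_ : Term → Term → Set
u ⊑ˢ v = ∀ w → ang w u ◁ ang w v

⊑ˢ-refl : ∀ t → t ⊑ˢ t
⊑ˢ-refl t w x∈ = lose x∈ (≼-refl (lookup (ang-angles w t) x∈))

⊑ˢ-inhabited : ∀ {u v} → u ⊑ˢ v → ∀ {a} → a ∈ u → ∃[ b ] b ∈ v
⊑ˢ-inhabited {u} {v} u⊑v {a} a∈ with angNS-inhabited ∞ a
... | x , x∈ with find (u⊑v ∞ (∈-ang⁺ ∞ u a∈ x∈))
... | y , y∈ , _ with ∈-ang⁻ ∞ v y∈
... | b , b∈ , _ = b , b∈

⊑ˢ-resp-≈ : ∀ {u u′ v v′} → u ≈ u′ → v ≈ v′ → u ⊑ˢ v → u′ ⊑ˢ v′
⊑ˢ-resp-≈ (_ , u′⊆u) (v⊆v′ , _) u⊑v w = Any-resp-⊆ (ang-⊆ w v⊆v′) ∘ u⊑v w ∘ ang-⊆ w u′⊆u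

⊑ˢ-conT : ∀ {u v} c → u ⊑ˢ v → conT c u ⊑ˢ conT c v
⊑ˢ-conT {u} {v} c u⊑v w rewrite ang-conT w c u | ang-conT w c v = u⊑v (w ⊕ one)

⊑ˢ-ang₀ : ∀ {u t} → ang (fin (+ 0)) u ⊑ˢ t → u ⊑ˢ t
⊑ˢ-ang₀ {u} u₀⊑t w = u₀⊑t w ∘ subst (_ ∈_) (sym (ang-ang₀ w u))

⊑ˢ-angSum : ∀ ps qs → (∀ {p} → p ∈ ps → ∃[ q ] q ∈ qs × angSum [ p ] ⊑ˢ angSum [ q ]) →
            angSum ps ⊑ˢ angSum qs
⊑ˢ-angSum ps qs dom w x∈ with ∈-ang⁻ w (angSum ps) x∈
... | _ , n∈ , x∈n with ∈-map⁻ _ n∈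
... | p , p∈ , refl with dom p∈
... | q , q∈ , p⊑q = Any-resp-⊆ (ang-⊆ w single⊆) (p⊑q w (∈-++⁺ˡ x∈n))
  where
    single⊆ : angSum [ q ] ⊆ angSum qs
    single⊆ (here refl) = ∈-map⁺ _ q∈

≼⇒⊑ˢ : ∀ {x y} → x ≼ y → [ x ] ⊑ˢ [ y ]
≼⇒⊑ˢ x≼y@(suffix _ _) w (here refl) = here (≼-shift w x≼y)

choices-∷⁻ : ∀ u us {ch} → ch ∈ choices (u ∷ us) →
             ∃[ a ] ∃[ ch₀ ] a ∈ u × ch₀ ∈ choices us × ch ≡ a ∷ ch₀
choices-∷⁻ u us ch∈ with find (∈-concatMap⁻ _ {u} ch∈)
... | a , a∈ , ch∈′ with ∈-map⁻ (a ∷_) ch∈′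
... | ch₀ , ch₀∈ , eq = a , ch₀ , a∈ , ch₀∈ , eq

choices-∷⁺ : ∀ u us {a ch₀} → a ∈ u → ch₀ ∈ choices us → a ∷ ch₀ ∈ choices (u ∷ us)
choices-∷⁺ u us a∈ ch₀∈ = ∈-concatMap⁺ _ {u} (lose a∈ (∈-map⁺ (_ ∷_) ch₀∈))

choices-inhabited : ∀ {us vs} → Pointwise _⊑ˢ_ us vs →
                    ∀ {ch} → ch ∈ choices us → ∃[ ch′ ] ch′ ∈ choices vs
choices-inhabited [] _ = [] , here refl
choices-inhabited {u ∷ us} {v ∷ vs} (u⊑v ∷ us⊑vs) ch∈ with choices-∷⁻ u us ch∈
... | _ , _ , a∈ , ch₀∈ , _ with ⊑ˢ-inhabited u⊑v a∈ | choices-inhabited us⊑vs ch₀∈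
... | b , b∈ | ch′ , ch′∈ = b ∷ ch′ , choices-∷⁺ v vs b∈ ch′∈

-- Different atoms of one choice may be dominated through different choices on the right.
choices-◁ : ∀ {us vs} → Pointwise _⊑ˢ_ us vs → ∀ w {ch} → ch ∈ choices us →
            ∀ {x} → x ∈ ang w ch → ∃[ ch′ ] ch′ ∈ choices vs × Any (x ≼_) (ang w ch′)
choices-◁ [] w (here refl) ()
choices-◁ {u ∷ us} {v ∷ vs} (u⊑v ∷ us⊑vs) w ch∈ x∈ with choices-∷⁻ u us ch∈
... | a , ch₀ , a∈ , ch₀∈ , refl with ∈-++⁻ (angNS w a) x∈
... | inj₁ x∈a with find (u⊑v w (∈-ang⁺ w u a∈ x∈a)) | choices-inhabited us⊑vs ch₀∈
... | y , y∈ , x≼y | ch′ , ch′∈ with ∈-ang⁻ w v y∈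
... | b , b∈ , y∈b = b ∷ ch′ , choices-∷⁺ v vs b∈ ch′∈ , lose (∈-++⁺ˡ y∈b) x≼y
choices-◁ {u ∷ us} {v ∷ vs} (u⊑v ∷ us⊑vs) w ch∈ x∈ | a , ch₀ , a∈ , ch₀∈ , refl | inj₂ x∈ch₀
  with choices-◁ us⊑vs w ch₀∈ x∈ch₀ | ⊑ˢ-inhabited u⊑v a∈
... | ch′ , ch′∈ , x≼ | b , b∈ =
  b ∷ ch′ , choices-∷⁺ v vs b∈ ch′∈ , Any-resp-⊆ (∈-++⁺ʳ (angNS w b)) x≼

∈-ang-tupT-∷⁻ : ∀ w u us {x} → x ∈ ang w (tupT (u ∷ us)) →
                ∃[ ch ] ch ∈ choices (u ∷ us) × x ∈ ang (w ⊕ one) ch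
∈-ang-tupT-∷⁻ w u us x∈ with ∈-ang⁻ w (tupT (u ∷ us)) x∈
... | _ , n∈ , x∈n with ∈-map⁻ tup n∈
... | ch , ch∈ , refl with choices-∷⁻ u us ch∈
... | _ , _ , _ , _ , refl = ch , ch∈ , x∈n

ang-tupT-∷⁺ : ∀ w v vs {ch} → ch ∈ choices (v ∷ vs) → ang (w ⊕ one) ch ⊆ ang w (tupT (v ∷ vs))
ang-tupT-∷⁺ w v vs ch∈ with choices-∷⁻ v vs ch∈
... | _ , _ , _ , _ , refl = ∈-ang⁺ w (tupT (v ∷ vs)) (∈-map⁺ tup ch∈)

⊑ˢ-tupT : ∀ {us vs} → Pointwise _⊑ˢ_ us vs → tupT us ⊑ˢ tupT vs
⊑ˢ-tupT [] = ⊑ˢ-refl (tupT [])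
⊑ˢ-tupT {u ∷ us} {v ∷ vs} us⊑vs w x∈ with ∈-ang-tupT-∷⁻ w u us x∈
... | ch , ch∈ , x∈ch with choices-◁ us⊑vs (w ⊕ one) ch∈ x∈ch
... | ch′ , ch′∈ , x≼ = Any-resp-⊆ (ang-tupT-∷⁺ w v vs ch′∈) x≼

mutual
  ⊑′⇒⊑ˢ : ∀ {u v} → u ⊑′ v → u ⊑ˢ v
  ⊑′⇒⊑ˢ (resp u≈u′ v≈v′ u⊑v)     = ⊑ˢ-resp-≈ u≈u′ v≈v′ (⊑′⇒⊑ˢ u⊑v)
  ⊑′⇒⊑ˢ (r-con {u} {v} c u⊑v)    = ⊑ˢ-conT {u} {v} c (⊑′⇒⊑ˢ u⊑v)
  ⊑′⇒⊑ˢ (r-tup us⊑vs)            = ⊑ˢ-tupT (Pointwise⊑⇒⊑ˢ us⊑vs)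
  ⊑′⇒⊑ˢ (r-ang {u} {v} w u₀⊑v)   = ⊑ˢ-ang₀ {u} {ang w v} (⊑′⇒⊑ˢ u₀⊑v)
  ⊑′⇒⊑ˢ (r-sum ps qs dom)        =
    ⊑ˢ-angSum ps qs λ p∈ → let q , q∈ , p⊑q = dom p∈ in q , q∈ , ⊑′⇒⊑ˢ p⊑q
  ⊑′⇒⊑ˢ (r-suf suf le)           = ≼⇒⊑ˢ (suffix suf le)
  ⊑′⇒⊑ˢ (r-refl d)               = ⊑ˢ-refl [ plain d ]

  Pointwise⊑⇒⊑ˢ : ∀ {us vs} → Pointwise⊑ us vs → Pointwise _⊑ˢ_ us vs
  Pointwise⊑⇒⊑ˢ []             = []
  Pointwise⊑⇒⊑ˢ (u⊑v ∷ us⊑vs) = ⊑′⇒⊑ˢ u⊑v ∷ Pointwise⊑⇒⊑ˢ us⊑vs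

◁⇒⊑′ : ∀ {t t′} → All IsAngle t → All IsAngle t′ → t ◁ t′ → t ⊑′ t′
◁⇒⊑′ angs angs′ t◁t′ with angles⇒angSum angs | angles⇒angSum angs′
... | ps , refl | qs , refl = r-sum ps qs dom
  where
    dom : ∀ {p} → p ∈ ps → ∃[ q ] q ∈ qs × angSum [ p ] ⊑′ angSum [ q ]
    dom p∈ with find (t◁t′ (∈-map⁺ _ p∈))
    ... | y , y∈ , x≼y with ∈-map⁻ _ y∈
    ... | q , q∈ , refl with x≼y
    ... | suffix suf le = q , q∈ , r-suf suf le

lemmaA2 : ∀ (u v : Term) (w : ℤ∞) → u ⊑′ v → ang w u ⊑′ ang w v
lemmaA2 u v w u⊑v = ◁⇒⊑′ (ang-angles w u) (ang-angles w v) (⊑′⇒⊑ˢ u⊑v w)
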